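{- Every recursively partitionable graph $G$ is $\tfrac13$-tough, i.e. for every $S\subseteq V(G)$ with $c(G-S)\geq 2$ we have $\frac{|S|}{c(G-S)}\geq \frac13$.
   Context: All graphs are finite and simple; $c(H)$ is the number of components of $H$. The toughness of $G$ is $\tau(G)=\min\{|S|/c(G-S) : S\subseteq V(G),\ c(G-S)\ge 2\}$, and $G$ is $r$-tough if $\tau(G)\ge r$. A graph $G$ on $n$ vertices is recursively partitionable (RP) if $G\simeq K_1$, or $G$ is connected and for every integer partition $a_1,\dots,a_k$ of $n$ there is a partition $\{A_1,\dots,A_k\}$ of $V(G)$ with $|A_i|=a_i$ such that each induced subgraph $G[A_i]$ is RP. -}

module Defs where

open import Data.Nat using (ℕ; zero; suc; _+_; _≤_; _<_)
open import Data.Fin using (Fin)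
open import Data.Fin.Subset using (Subset; _∈_; _∉_; _⊆_; ∣_∣; Nonempty)
open import Data.Bool using (Bool; true)
open import Data.Product using (Σ; _×_; ∃; ∃-syntax)
open import Relation.Nullary using (¬_)
open import Relation.Binary.PropositionalEquality using (_≡_)

record Graph (n : ℕ) : Set where
  field
    adj    : Fin n → Fin n → Bool
    sym    : ∀ x y → adj x y ≡ adj y x
    irrefl : ∀ x → ¬ (adj x x ≡ true)
open Graph public

Σsum : ∀ {k} → (Fin k → ℕ) → ℕ
Σsum {zero}  a = 0
Σsum {suc k} a = a Fin.zero + Σsum (λ i → a (Fin.suc i))

module _ {n : ℕ} (G : Graph n) where

  data Reach (U : Subset n) (x : Fin n) : Fin n → Set where
    here : x ∈ U → Reach U x x
    step : ∀ {y z} → Reach U x y → adj G y z ≡ true → z ∈ U → Reach U x z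

  Connected : Subset n → Set
  Connected U = Nonempty U × (∀ x y → x ∈ U → y ∈ U → Reach U x y)

  IsPartition : ∀ {k} → Subset n → (Fin k → Subset n) → Set
  IsPartition U A =
      (∀ i → A i ⊆ U)
    × (∀ i j x → x ∈ A i → x ∈ A j → i ≡ j)
    × (∀ x → x ∈ U → ∃[ i ] x ∈ A i)

  -- An integer partition of m into k ≥ 2 positive parts.
  -- (The trivial partition k = 1 is satisfied by A₁ = V(G) itself.)
  IsNontrivialIntPartition : ∀ {k} → ℕ → (Fin k → ℕ) → Set
  IsNontrivialIntPartition {k} m a = (2 ≤ k) × (∀ i → 1 ≤ a i) × (Σsum a ≡ m)

  data RP (U : Subset n) : Set where
    rp-K1 : ∣ U ∣ ≡ 1 → RP U
    rp    : Connected U →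
            (∀ k (a : Fin k → ℕ) → IsNontrivialIntPartition ∣ U ∣ a →
               Σ (Fin k → Subset n) λ A →
                 IsPartition U A × (∀ i → ∣ A i ∣ ≡ a i) × (∀ i → RP (A i))) →
            RP U

  -- The vertex sets C : Fin c → Subset n are the c components of G[W]:
  -- a partition of W into nonempty connected parts with no edges between
  -- distinct parts (so each part is a maximal connected subgraph).
  IsComponents : ∀ {c} → Subset n → (Fin c → Subset n) → Set
  IsComponents W C =
      IsPartition W C
    × (∀ i → Connected (C i))
    × (∀ i j x y → x ∈ C i → y ∈ C j → adj G x y ≡ true → i ≡ j)

  NumComponents : Subset n → ℕ → Set
  NumComponents W c = Σ (Fin c → Subset n) λ C → IsComponents W C

-- Let R contain one vertex of each component of G[U] − S; by induction on the
-- recursive partition, |R| ≤ 1 or |R| ≤ 3|S ∩ U|. If S meets U and |R| is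
-- larger, split U into two RP parts of any prescribed sizes. If both parts meet
-- S, induction bounds |R|. If one part misses S, it is connected and avoids S,
-- so it is a whole component of G[U] − S, or else it passes its vertex of R
-- across an edge to the other part and induction bounds |R| again. Hence every
-- split of |U| is realised by the size of a component. But with more than
-- 3|S ∩ U| ≥ 3 components, any two components leave at least three vertices of
-- U uncovered, and no such family of sets realises every split.

{-# OPTIONS --safe #-}
module Submission where

open import Defs hiding (sym)
open import Data.Bool using (true)
import Data.Bool.Properties as Bool
open import Data.Fin using (Fin; zero; suc; _≟_)
open import Data.Fin.Properties using (any?; suc-injective)
open import Data.Fin.Subset
open import Data.Fin.Subset.Properties
open import Data.Nat using (ℕ; suc; _+_; _*_; _≤_; _<_; z≤n; s≤s; s≤s⁻¹; ⌊_/2⌋; ⌈_/2⌉)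
open import Data.Nat.Properties hiding (_≟_; suc-injective)
open import Data.Nat.Tactic.RingSolver using (solve-∀)
open import Data.Product using (∃; _×_; _,_; proj₁; proj₂)
open import Data.Sum using (_⊎_; inj₁; inj₂; [_,_]; map; map₂)
open import Data.Vec using (_∷_; []; here; there)
open import Function using (_∘_; id)
open import Function.Definitions using (Injective)
open import Relation.Nullary using (¬_; Dec; yes; no; contradiction)
open import Relation.Nullary.Decidable using (_×-dec_; ¬?)
open import Relation.Binary.PropositionalEquality using (_≡_; _≢_; refl; sym; trans; cong; cong₂; subst; subst₂)

Disjoint : ∀ {n} → Subset n → Subset n → Set
Disjoint p q = ∀ {x} → x ∈ p → x ∉ q

Subsingleton : ∀ {n} → Subset n → Set
Subsingleton p = ∀ {x y} → x ∈ p → y ∈ p → x ≡ y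

x∈p⇒1≤∣p∣ : ∀ {n x} {p : Subset n} → x ∈ p → 1 ≤ ∣ p ∣
x∈p⇒1≤∣p∣ x∈p = ≤-trans (s≤s z≤n) (x∈p⇒∣p-x∣<∣p∣ x∈p)

Empty⇒∣p∣≡0 : ∀ {n} {p : Subset n} → Empty p → ∣ p ∣ ≡ 0
Empty⇒∣p∣≡0 {n} empty = trans (cong ∣_∣ (Empty-unique empty)) (∣⊥∣≡0 n)

p⊆q⇒p∩r⊆q∩r : ∀ {n} {p q r : Subset n} → p ⊆ q → p ∩ r ⊆ q ∩ r
p⊆q⇒p∩r⊆q∩r {p = p} {r = r} p⊆q x∈ = x∈p∩q⁺ (p⊆q (p∩q⊆p p r x∈) , p∩q⊆q p r x∈)

p⊆q⇒∣p∩q∣≡∣p∣ : ∀ {n} {p q : Subset n} → p ⊆ q → ∣ p ∩ q ∣ ≡ ∣ p ∣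
p⊆q⇒∣p∩q∣≡∣p∣ {p = p} {q} p⊆q =
  cong ∣_∣ (⊆-antisym (p∩q⊆p p q) (λ x∈p → x∈p∩q⁺ (x∈p , p⊆q x∈p)))

∣p∣≡∣p∩q∣+∣p∩∁q∣ : ∀ {n} (p q : Subset n) → ∣ p ∣ ≡ ∣ p ∩ q ∣ + ∣ p ∩ ∁ q ∣
∣p∣≡∣p∩q∣+∣p∩∁q∣ []            []            = refl
∣p∣≡∣p∩q∣+∣p∩∁q∣ (inside  ∷ p) (inside  ∷ q) = cong suc (∣p∣≡∣p∩q∣+∣p∩∁q∣ p q)
∣p∣≡∣p∩q∣+∣p∩∁q∣ (inside  ∷ p) (outside ∷ q) =
  trans (cong suc (∣p∣≡∣p∩q∣+∣p∩∁q∣ p q)) (sym (+-suc _ _))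
∣p∣≡∣p∩q∣+∣p∩∁q∣ (outside ∷ p) (_       ∷ q) = ∣p∣≡∣p∩q∣+∣p∩∁q∣ p q

drop-∷-Disjoint : ∀ {n} {s t} {p q : Subset n} → Disjoint (s ∷ p) (t ∷ q) → Disjoint p q
drop-∷-Disjoint disj x∈p x∈q = disj (there x∈p) (there x∈q)

∣p∪q∣≡∣p∣+∣q∣ : ∀ {n} {p q : Subset n} → Disjoint p q → ∣ p ∪ q ∣ ≡ ∣ p ∣ + ∣ q ∣
∣p∪q∣≡∣p∣+∣q∣ {p = []}          {[]}          _    = refl
∣p∪q∣≡∣p∣+∣q∣ {p = inside  ∷ p} {inside  ∷ q} disj = contradiction here (disj here)
∣p∪q∣≡∣p∣+∣q∣ {p = inside  ∷ p} {outside ∷ q} disj = cong suc (∣p∪q∣≡∣p∣+∣q∣ (drop-∷-Disjoint disj))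
∣p∪q∣≡∣p∣+∣q∣ {p = outside ∷ p} {inside  ∷ q} disj =
  trans (cong suc (∣p∪q∣≡∣p∣+∣q∣ (drop-∷-Disjoint disj))) (sym (+-suc _ _))
∣p∪q∣≡∣p∣+∣q∣ {p = outside ∷ p} {outside ∷ q} disj = ∣p∪q∣≡∣p∣+∣q∣ (drop-∷-Disjoint disj)

∣p∣+∣q∣≤∣u∣ : ∀ {n} {p q u : Subset n} → Disjoint p q → p ⊆ u → q ⊆ u → ∣ p ∣ + ∣ q ∣ ≤ ∣ u ∣
∣p∣+∣q∣≤∣u∣ {p = p} {q} disj p⊆u q⊆u =
  subst (_≤ _) (∣p∪q∣≡∣p∣+∣q∣ disj) (p⊆q⇒∣p∣≤∣q∣ ([ p⊆u , q⊆u ] ∘ x∈p∪q⁻ p q))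

Subsingleton⇒∣p∣≤1 : ∀ {n} {p : Subset n} → Subsingleton p → ∣ p ∣ ≤ 1
Subsingleton⇒∣p∣≤1 {p = p} single with nonempty? p
... | no  empty     = subst (_≤ 1) (sym (Empty⇒∣p∣≡0 empty)) z≤n
... | yes (x , x∈p) = subst (∣ p ∣ ≤_) (∣⁅x⁆∣≡1 x) (p⊆q⇒∣p∣≤∣q∣ p⊆⁅x⁆)
  where
  p⊆⁅x⁆ : p ⊆ ⁅ x ⁆
  p⊆⁅x⁆ y∈p = subst (_∈ ⁅ x ⁆) (single x∈p y∈p) (x∈⁅x⁆ x)

∣p∣≤1⇒Subsingleton : ∀ {n} {p : Subset n} → ∣ p ∣ ≤ 1 → Subsingleton p
∣p∣≤1⇒Subsingleton ∣p∣≤1 {x} {y} x∈p y∈p with x ≟ y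
... | yes x≡y = x≡y
... | no  x≢y = contradiction (x∈p⇒1≤∣p∣ (x∈p∧x≢y⇒x∈p-y y∈p (x≢y ∘ sym)))
                              (<⇒≱ (≤-trans (x∈p⇒∣p-x∣<∣p∣ x∈p) ∣p∣≤1))

Bipartition : ∀ {n} → Subset n → Subset n → Subset n → Set
Bipartition U A B = A ⊆ U × B ⊆ U × Disjoint A B × (∀ {x} → x ∈ U → x ∈ A ⊎ x ∈ B)

module _ {n : ℕ} {U A B : Subset n} where

  bipartition-swap : Bipartition U A B → Bipartition U B A
  bipartition-swap (A⊆U , B⊆U , disj , cover) =
    B⊆U , A⊆U , (λ x∈B x∈A → disj x∈A x∈B) , [ inj₂ , inj₁ ] ∘ cover

  ∣p∩u∣≡∣p∩a∣+∣p∩b∣ : Bipartition U A B → ∀ p → ∣ p ∩ U ∣ ≡ ∣ p ∩ A ∣ + ∣ p ∩ B ∣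
  ∣p∩u∣≡∣p∩a∣+∣p∩b∣ (A⊆U , B⊆U , disj , cover) p =
    trans (cong ∣_∣ (⊆-antisym split join)) (∣p∪q∣≡∣p∣+∣q∣ disj′)
    where
    split : p ∩ U ⊆ p ∩ A ∪ p ∩ B
    split x∈ with x∈p∩q⁻ p U x∈
    ... | x∈p , x∈U = x∈p∪q⁺ (map (x∈p∩q⁺ ∘ (x∈p ,_)) (x∈p∩q⁺ ∘ (x∈p ,_)) (cover x∈U))
    join : p ∩ A ∪ p ∩ B ⊆ p ∩ U
    join x∈ with x∈p∪q⁻ (p ∩ A) (p ∩ B) x∈
    ... | inj₁ x∈p∩A = x∈p∩q⁺ (p∩q⊆p p A x∈p∩A , A⊆U (p∩q⊆q p A x∈p∩A))
    ... | inj₂ x∈p∩B = x∈p∩q⁺ (p∩q⊆p p B x∈p∩B , B⊆U (p∩q⊆q p B x∈p∩B))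
    disj′ : Disjoint (p ∩ A) (p ∩ B)
    disj′ x∈p∩A x∈p∩B = disj (p∩q⊆q p A x∈p∩A) (p∩q⊆q p B x∈p∩B)

  ∣p∣≡∣p∩a∣+∣p∩b∣ : Bipartition U A B → ∀ {p} → p ⊆ U → ∣ p ∣ ≡ ∣ p ∩ A ∣ + ∣ p ∩ B ∣
  ∣p∣≡∣p∩a∣+∣p∩b∣ bip {p} p⊆U = trans (sym (p⊆q⇒∣p∩q∣≡∣p∣ p⊆U)) (∣p∩u∣≡∣p∩a∣+∣p∩b∣ bip p)

IsPartition⇒Bipartition : ∀ {n} (G : Graph n) {U} {A : Fin 2 → Subset n} →
                          IsPartition G U A → Bipartition U (A zero) (A (suc zero))
IsPartition⇒Bipartition _ {U} {A} (A⊆U , A-disjoint , A-cover) =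
  A⊆U zero , A⊆U (suc zero) , disjoint , cover
  where
  disjoint : Disjoint (A zero) (A (suc zero))
  disjoint x∈A₀ x∈A₁ with A-disjoint zero (suc zero) _ x∈A₀ x∈A₁
  ... | ()
  cover : ∀ {x} → x ∈ U → x ∈ A zero ⊎ x ∈ A (suc zero)
  cover x∈U with A-cover _ x∈U
  ... | zero     , x∈A₀ = inj₁ x∈A₀
  ... | suc zero , x∈A₁ = inj₂ x∈A₁

image : ∀ {n c} → (Fin c → Fin n) → Subset n
image {c = 0}     f = ⊥
image {c = suc c} f = ⁅ f zero ⁆ ∪ image (f ∘ suc)

∈-image⁻ : ∀ {n c} (f : Fin c → Fin n) {x} → x ∈ image f → ∃ λ i → f i ≡ x
∈-image⁻ {c = 0}     f x∈ = contradiction x∈ ∉⊥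
∈-image⁻ {c = suc c} f x∈ with x∈p∪q⁻ ⁅ f zero ⁆ (image (f ∘ suc)) x∈
... | inj₁ x∈⁅f0⁆ = zero , sym (x∈⁅y⁆⇒x≡y (f zero) x∈⁅f0⁆)
... | inj₂ x∈img with ∈-image⁻ (f ∘ suc) x∈img
...   | i , fi≡x = suc i , fi≡x

∣image∣≡c : ∀ {n c} (f : Fin c → Fin n) → Injective _≡_ _≡_ f → ∣ image f ∣ ≡ c
∣image∣≡c {n} {0}     f _   = ∣⊥∣≡0 n
∣image∣≡c {c = suc c} f inj = trans (∣p∪q∣≡∣p∣+∣q∣ disjoint)
  (cong₂ _+_ (∣⁅x⁆∣≡1 (f zero)) (∣image∣≡c (f ∘ suc) (suc-injective ∘ inj)))
  where
  disjoint : Disjoint ⁅ f zero ⁆ (image (f ∘ suc))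
  disjoint x∈⁅f0⁆ x∈img with ∈-image⁻ (f ∘ suc) x∈img
  ... | i , fi≡x with inj (trans fi≡x (x∈⁅y⁆⇒x≡y (f zero) x∈⁅f0⁆))
  ...   | ()

⌊n/2⌋≤σ⇒t≤σ : ∀ {N σ t} → ⌊ N /2⌋ ≤ σ → σ + 3 + t ≡ N → t ≤ σ
⌊n/2⌋≤σ⇒t≤σ {N} {σ} {t} ⌊N/2⌋≤σ N≡ =
  ≤-trans (m≤n+m t 2) (s≤s⁻¹ (+-cancelˡ-≤ σ (3 + t) (suc σ) (begin
    σ + (3 + t)          ≡⟨ sym (+-assoc σ 3 t) ⟩
    σ + 3 + t            ≡⟨ N≡ ⟩
    N                    ≡⟨ sym (⌊n/2⌋+⌈n/2⌉≡n N) ⟩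
    ⌊ N /2⌋ + ⌈ N /2⌉    ≤⟨ +-mono-≤ ⌊N/2⌋≤σ (≤-trans (⌊n/2⌋-mono (n≤1+n (suc N))) (s≤s ⌊N/2⌋≤σ)) ⟩
    σ + suc σ            ∎)))
  where open ≤-Reasoning

Splits : ∀ {n} → (Subset n → Set) → ℕ → Set
Splits P N = ∀ a b → 1 ≤ a → 1 ≤ b → a + b ≡ N → ∃ λ X → P X × (∣ X ∣ ≡ a ⊎ ∣ X ∣ ≡ b)

module _ {n N} (P : Subset n → Set) (P-⊥ : P ⊥)
         (meet : ∀ {X Y} → P X → P Y → Nonempty (X ∩ Y) → ∣ X ∣ ≡ ∣ Y ∣)
         (gap : ∀ {X Y} → P X → P Y → Disjoint X Y → ∣ X ∣ + ∣ Y ∣ + 3 ≤ N)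
         where

  private
    size-bound : ∀ {X} → P X → ∣ X ∣ + 3 ≤ N
    size-bound {X} pX = subst (λ k → k + 3 ≤ N)
      (trans (cong (∣ X ∣ +_) (∣⊥∣≡0 n)) (+-identityʳ ∣ X ∣)) (gap pX P-⊥ (λ _ → ∉⊥))

    1≤⌊N/2⌋ : 1 ≤ ⌊ N /2⌋
    1≤⌊N/2⌋ = ⌊n/2⌋-mono (≤-trans (n≤1+n 2) (subst (λ k → k + 3 ≤ N) (∣⊥∣≡0 n) (size-bound P-⊥)))

    large-set : Splits P N → ∃ λ X → P X × ⌊ N /2⌋ ≤ ∣ X ∣
    large-set splits with splits ⌈ N /2⌉ ⌊ N /2⌋ (≤-trans 1≤⌊N/2⌋ (⌊n/2⌋≤⌈n/2⌉ N)) 1≤⌊N/2⌋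
                                 (trans (+-comm ⌈ N /2⌉ ⌊ N /2⌋) (⌊n/2⌋+⌈n/2⌉≡n N))
    ... | X , pX , inj₁ ∣X∣≡⌈N/2⌉ = X , pX , subst (⌊ N /2⌋ ≤_) (sym ∣X∣≡⌈N/2⌉) (⌊n/2⌋≤⌈n/2⌉ N)
    ... | X , pX , inj₂ ∣X∣≡⌊N/2⌋ = X , pX , ≤-reflexive (sym ∣X∣≡⌊N/2⌋)

    -- A set Y realising the split (a, b) can neither meet X (its size is not ∣X∣)
    -- nor avoid it (then ∣Y∣ ≤ t).
    split-missing : ∀ {X} → P X → ∀ {t} → ∣ X ∣ + 3 + t ≡ N →
                    ∀ {a b} → t < a → t < b → a ≢ ∣ X ∣ → b ≢ ∣ X ∣ → a + b ≡ N → ¬ Splits P N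
    split-missing {X} pX {t} N≡ {a} {b} t<a t<b a≢∣X∣ b≢∣X∣ a+b≡N splits
      with splits a b (≤-trans (s≤s z≤n) t<a) (≤-trans (s≤s z≤n) t<b) a+b≡N
    ... | Y , pY , ∣Y∣≡a⊎b with nonempty? (X ∩ Y)
    ...   | yes X∩Y≠∅ = [ a≢∣X∣ ∘ size , b≢∣X∣ ∘ size ] ∣Y∣≡a⊎b
      where
      size : ∀ {k} → ∣ Y ∣ ≡ k → k ≡ ∣ X ∣
      size ∣Y∣≡k = trans (sym ∣Y∣≡k) (sym (meet pX pY X∩Y≠∅))
    ...   | no  X∩Y=∅ = [ too-big t<a , too-big t<b ] ∣Y∣≡a⊎b
      where
      open ≤-Reasoning
      ∣Y∣≤t : ∣ Y ∣ ≤ t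
      ∣Y∣≤t = +-cancelˡ-≤ (∣ X ∣ + 3) (∣ Y ∣) t (begin
        ∣ X ∣ + 3 + ∣ Y ∣  ≡⟨ +-assoc (∣ X ∣) 3 (∣ Y ∣) ⟩
        ∣ X ∣ + (3 + ∣ Y ∣) ≡⟨ cong (∣ X ∣ +_) (+-comm 3 (∣ Y ∣)) ⟩
        ∣ X ∣ + (∣ Y ∣ + 3) ≡⟨ sym (+-assoc (∣ X ∣) (∣ Y ∣) 3) ⟩
        ∣ X ∣ + ∣ Y ∣ + 3  ≤⟨ gap pX pY (λ x∈X x∈Y → X∩Y=∅ (_ , x∈p∩q⁺ (x∈X , x∈Y))) ⟩
        N                  ≡⟨ sym N≡ ⟩
        ∣ X ∣ + 3 + t      ∎)
      too-big : ∀ {k} → t < k → ∣ Y ∣ ≢ k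
      too-big t<k ∣Y∣≡k = <⇒≱ t<k (subst (_≤ t) ∣Y∣≡k ∣Y∣≤t)

  -- With ∣X∣ ≥ ⌊N/2⌋ and N = ∣X∣ + 3 + t, the split (∣X∣ + 1, t + 2) has both
  -- parts larger than t, and it avoids ∣X∣ unless ∣X∣ = t + 2, in which case
  -- (t + 4, t + 1) does.
  no-splitting : ¬ Splits P N
  no-splitting splits with large-set splits
  ... | X , pX , ⌊N/2⌋≤∣X∣ with m≤n⇒∃[o]m+o≡n (size-bound pX)
  ...   | t , N≡ with ∣ X ∣ Data.Nat.≟ 2 + t
  ...     | no ∣X∣≢2+t = split-missing pX N≡ (s≤s (⌊n/2⌋≤σ⇒t≤σ ⌊N/2⌋≤∣X∣ N≡)) (s≤s (n≤1+n t))
              (>⇒≢ (n<1+n ∣ X ∣)) (∣X∣≢2+t ∘ sym) (trans (sum ∣ X ∣ t) N≡) splits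
    where
    sum : ∀ σ t → suc σ + (2 + t) ≡ σ + 3 + t
    sum = solve-∀
  ...     | yes ∣X∣≡2+t = split-missing pX N≡ (s≤s (m≤n+m t 3)) (n<1+n t)
              (λ e → >⇒≢ (n≤1+n (3 + t)) (trans e ∣X∣≡2+t))
              (λ e → <⇒≢ (n<1+n (1 + t)) (trans e ∣X∣≡2+t))
              (trans (sum t) (trans (cong (λ σ → σ + 3 + t) (sym ∣X∣≡2+t)) N≡)) splits
    where
    sum : ∀ t → (4 + t) + (1 + t) ≡ (2 + t) + 3 + t
    sum = solve-∀

module _ {n : ℕ} (G : Graph n) where

  reach-target : ∀ {U x y} → Reach G U x y → y ∈ U
  reach-target (here x∈U)     = x∈U
  reach-target (step _ _ z∈U) = z∈U

  reach-mono : ∀ {U V x y} → U ⊆ V → Reach G U x y → Reach G V x y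
  reach-mono U⊆V (here x∈U)          = here (U⊆V x∈U)
  reach-mono U⊆V (step x⇝y y~z z∈U) = step (reach-mono U⊆V x⇝y) y~z (U⊆V z∈U)

  reach-trans : ∀ {U x y z} → Reach G U x y → Reach G U y z → Reach G U x z
  reach-trans x⇝y (here _)            = x⇝y
  reach-trans x⇝y (step y⇝z z~w w∈U) = step (reach-trans x⇝y y⇝z) z~w w∈U

  reach-sym : ∀ {U x y} → Reach G U x y → Reach G U y x
  reach-sym (here x∈U)                      = here x∈U
  reach-sym (step {y} {z} x⇝y y~z z∈U) =
    reach-trans (step (here z∈U) (trans (Graph.sym G z y) y~z) (reach-target x⇝y)) (reach-sym x⇝y)

  Linked : Subset n → Set
  Linked U = ∀ x y → x ∈ U → y ∈ U → Reach G U x y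

  RP⇒Linked : ∀ {U} → RP G U → Linked U
  RP⇒Linked (rp-K1 ∣U∣≡1) x y x∈U y∈U with ∣p∣≤1⇒Subsingleton (≤-reflexive ∣U∣≡1) x∈U y∈U
  ... | refl = here x∈U
  RP⇒Linked (rp (_ , linked) _) = linked

module _ {n : ℕ} (G : Graph n) (S : Subset n) where

  Separated : Subset n → Subset n → Set
  Separated U R = R ⊆ U ∩ ∁ S × (∀ {x y} → x ∈ R → y ∈ R → Reach G (U ∩ ∁ S) x y → x ≡ y)

  -- The empty set qualifies too.
  Component : Subset n → Subset n → Set
  Component U X = X ⊆ U ∩ ∁ S × Linked G X
                × (∀ {x y} → x ∈ X → y ∈ U ∩ ∁ S → adj G x y ≡ true → y ∈ X)

  separated⇒⊆ : ∀ {U R} → Separated U R → R ⊆ U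
  separated⇒⊆ {U} (R⊆ , _) = p∩q⊆p U (∁ S) ∘ R⊆

  separated-∩ : ∀ {U A R} → A ⊆ U → Separated U R → Separated A (R ∩ A)
  separated-∩ {U} {A} {R} A⊆U (R⊆ , unique) = R∩A⊆ , λ x∈ y∈ x⇝y →
    unique (p∩q⊆p R A x∈) (p∩q⊆p R A y∈) (reach-mono G (p⊆q⇒p∩r⊆q∩r A⊆U) x⇝y)
    where
    R∩A⊆ : R ∩ A ⊆ A ∩ ∁ S
    R∩A⊆ x∈ = x∈p∩q⁺ (p∩q⊆q R A x∈ , p∩q⊆q U (∁ S) (R⊆ (p∩q⊆p R A x∈)))

  ∣R∩B∣≤1 : ∀ {U R B} → Separated U R → B ⊆ U ∩ ∁ S → Linked G B → ∣ R ∩ B ∣ ≤ 1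
  ∣R∩B∣≤1 {R = R} {B} (_ , unique) B⊆ B-linked = Subsingleton⇒∣p∣≤1 λ x∈ y∈ →
    unique (p∩q⊆p R B x∈) (p∩q⊆p R B y∈)
           (reach-mono G B⊆ (B-linked _ _ (p∩q⊆q R B x∈) (p∩q⊆q R B y∈)))

  component-⊥ : ∀ {U} → Component U ⊥
  component-⊥ = ⊥⊆ , (λ _ _ x∈⊥ → contradiction x∈⊥ ∉⊥) , λ x∈⊥ → contradiction x∈⊥ ∉⊥

  component-reach : ∀ {U X x y} → Component U X → x ∈ X → Reach G (U ∩ ∁ S) x y → y ∈ X
  component-reach _                   x∈X (here _) = x∈X
  component-reach cX@(_ , _ , closed) x∈X (step x⇝y y~z z∈) =
    closed (component-reach cX x∈X x⇝y) z∈ y~z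

  component-meet : ∀ {U X Y} → Component U X → Component U Y → Nonempty (X ∩ Y) → ∣ X ∣ ≡ ∣ Y ∣
  component-meet {X = X} {Y} cX cY (z , z∈X∩Y) =
    cong ∣_∣ (⊆-antisym (⊆-from cX cY (p∩q⊆p X Y z∈X∩Y) (p∩q⊆q X Y z∈X∩Y))
                        (⊆-from cY cX (p∩q⊆q X Y z∈X∩Y) (p∩q⊆p X Y z∈X∩Y)))
    where
    ⊆-from : ∀ {U V W z} → Component U V → Component U W → z ∈ V → z ∈ W → V ⊆ W
    ⊆-from (V⊆ , V-linked , _) cW z∈V z∈W w∈V =
      component-reach cW z∈W (reach-mono G V⊆ (V-linked _ _ z∈V w∈V))

  ∣R∣≤2+∣R∖X∖Z∣ : ∀ {U R X Z} → Separated U R → Component U X → Component U Z →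
                  ∣ R ∣ ≤ 2 + ∣ (R ∩ ∁ X) ∩ ∁ Z ∣
  ∣R∣≤2+∣R∖X∖Z∣ {R = R} {X} {Z} sep (X⊆ , X-linked , _) (Z⊆ , Z-linked , _) = begin
    ∣ R ∣                            ≡⟨ ∣p∣≡∣p∩q∣+∣p∩∁q∣ R X ⟩
    ∣ R ∩ X ∣ + ∣ R∖X ∣              ≡⟨ cong (∣ R ∩ X ∣ +_) (∣p∣≡∣p∩q∣+∣p∩∁q∣ R∖X Z) ⟩
    ∣ R ∩ X ∣ + (∣ R∖X ∩ Z ∣ + ∣ R∖X ∩ ∁ Z ∣)
      ≤⟨ +-mono-≤ (∣R∩B∣≤1 sep X⊆ X-linked)
                  (+-monoˡ-≤ _ (≤-trans (p⊆q⇒∣p∣≤∣q∣ R∖X∩Z⊆R∩Z) (∣R∩B∣≤1 sep Z⊆ Z-linked))) ⟩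
    2 + ∣ R∖X ∩ ∁ Z ∣                ∎
    where
    open ≤-Reasoning
    R∖X = R ∩ ∁ X
    R∖X∩Z⊆R∩Z : R∖X ∩ Z ⊆ R ∩ Z
    R∖X∩Z⊆R∩Z x∈ = x∈p∩q⁺ (p∩q⊆p R (∁ X) (p∩q⊆p R∖X Z x∈) , p∩q⊆q R∖X Z x∈)

  -- X, Z, S ∩ U and R ∖ (X ∪ Z) are disjoint parts of U.
  separated-gap : ∀ {U R X Z} → Separated U R → Component U X → Component U Z → Disjoint X Z →
                  ∣ X ∣ + ∣ Z ∣ + ∣ S ∩ U ∣ + ∣ R ∣ ≤ ∣ U ∣ + 2
  separated-gap {U} {R} {X} {Z} sep cX@(X⊆ , _) cZ@(Z⊆ , _) X∩Z=∅ = begin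
    ∣ X ∣ + ∣ Z ∣ + ∣ T ∣ + ∣ R ∣        ≤⟨ +-monoʳ-≤ (∣ X ∣ + ∣ Z ∣ + ∣ T ∣) (∣R∣≤2+∣R∖X∖Z∣ sep cX cZ) ⟩
    ∣ X ∣ + ∣ Z ∣ + ∣ T ∣ + (2 + ∣ Q ∣)  ≡⟨ regroup (∣ X ∣) (∣ Z ∣) (∣ T ∣) (∣ Q ∣) ⟩
    ∣ X ∣ + ∣ Z ∣ + (∣ T ∣ + ∣ Q ∣) + 2  ≡⟨ cong₂ (λ a b → a + b + 2) (sym (∣p∪q∣≡∣p∣+∣q∣ X∩Z=∅))
                                                                     (sym (∣p∪q∣≡∣p∣+∣q∣ T∩Q=∅)) ⟩
    ∣ X ∪ Z ∣ + ∣ T ∪ Q ∣ + 2           ≤⟨ +-monoˡ-≤ 2 (∣p∣+∣q∣≤∣u∣ apart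
                                             ([ X⊆U , Z⊆U ] ∘ x∈p∪q⁻ X Z) ([ T⊆U , Q⊆U ] ∘ x∈p∪q⁻ T Q)) ⟩
    ∣ U ∣ + 2                           ∎
    where
    open ≤-Reasoning
    T = S ∩ U
    Q = (R ∩ ∁ X) ∩ ∁ Z
    regroup : ∀ x z t q → x + z + t + (2 + q) ≡ x + z + (t + q) + 2
    regroup = solve-∀
    X⊆U : X ⊆ U
    X⊆U = p∩q⊆p U (∁ S) ∘ X⊆
    Z⊆U : Z ⊆ U
    Z⊆U = p∩q⊆p U (∁ S) ∘ Z⊆
    T⊆U : T ⊆ U
    T⊆U = p∩q⊆q S U
    Q⊆R : Q ⊆ R
    Q⊆R = p∩q⊆p R (∁ X) ∘ p∩q⊆p (R ∩ ∁ X) (∁ Z)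
    Q⊆U : Q ⊆ U
    Q⊆U = separated⇒⊆ sep ∘ Q⊆R
    ∉T : ∀ {x} → x ∈ U ∩ ∁ S → x ∉ T
    ∉T x∈ x∈T = x∈∁p⇒x∉p (p∩q⊆q U (∁ S) x∈) (p∩q⊆p S U x∈T)
    T∩Q=∅ : Disjoint T Q
    T∩Q=∅ x∈T x∈Q = ∉T (proj₁ sep (Q⊆R x∈Q)) x∈T
    apart : Disjoint (X ∪ Z) (T ∪ Q)
    apart x∈X∪Z x∈T∪Q with x∈p∪q⁻ X Z x∈X∪Z | x∈p∪q⁻ T Q x∈T∪Q
    ... | inj₁ x∈X | inj₁ x∈T = ∉T (X⊆ x∈X) x∈T
    ... | inj₂ x∈Z | inj₁ x∈T = ∉T (Z⊆ x∈Z) x∈T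
    ... | inj₁ x∈X | inj₂ x∈Q = x∈∁p⇒x∉p (p∩q⊆q R (∁ X) (p∩q⊆p (R ∩ ∁ X) (∁ Z) x∈Q)) x∈X
    ... | inj₂ x∈Z | inj₂ x∈Q = x∈∁p⇒x∉p (p∩q⊆q (R ∩ ∁ X) (∁ Z) x∈Q) x∈Z

  -- When a vertex r of R reaches a ∈ A outside B ∋ r, the vertex a can stand in
  -- for r: whatever a reaches, r reaches as well.
  separated-replace : ∀ {U A B R r a} → Separated U R → Disjoint A B → A ⊆ U →
                      r ∈ R → r ∈ B → a ∈ A ∩ ∁ S → Reach G (U ∩ ∁ S) r a →
                      a ∉ R × Separated A (R ∩ A ∪ ⁅ a ⁆)
  separated-replace {U} {A} {B} {R} {r} {a} (R⊆ , unique) A∩B=∅ A⊆U r∈R r∈B a∈A∖S r⇝a =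
    a∉R , R′⊆ , unique′
    where
    A∖S⊆U∖S : A ∩ ∁ S ⊆ U ∩ ∁ S
    A∖S⊆U∖S = p⊆q⇒p∩r⊆q∩r A⊆U
    unreachable : ∀ {y} → y ∈ R → y ∈ A → ¬ Reach G (U ∩ ∁ S) a y
    unreachable y∈R y∈A a⇝y =
      A∩B=∅ y∈A (subst (_∈ B) (unique r∈R y∈R (reach-trans G r⇝a a⇝y)) r∈B)
    a∉R : a ∉ R
    a∉R a∈R = unreachable a∈R (p∩q⊆p A (∁ S) a∈A∖S) (here (A∖S⊆U∖S a∈A∖S))
    member : ∀ {x} → x ∈ R ∩ A ∪ ⁅ a ⁆ → x ∈ R ∩ A ⊎ x ≡ a
    member x∈ = map₂ (x∈⁅y⁆⇒x≡y a) (x∈p∪q⁻ (R ∩ A) ⁅ a ⁆ x∈)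
    R′⊆ : R ∩ A ∪ ⁅ a ⁆ ⊆ A ∩ ∁ S
    R′⊆ x∈ with member x∈
    ... | inj₁ x∈R∩A = x∈p∩q⁺ (p∩q⊆q R A x∈R∩A , p∩q⊆q U (∁ S) (R⊆ (p∩q⊆p R A x∈R∩A)))
    ... | inj₂ refl  = a∈A∖S
    unique′ : ∀ {x y} → x ∈ R ∩ A ∪ ⁅ a ⁆ → y ∈ R ∩ A ∪ ⁅ a ⁆ → Reach G (A ∩ ∁ S) x y → x ≡ y
    unique′ x∈ y∈ x⇝y with member x∈ | member y∈ | reach-mono G A∖S⊆U∖S x⇝y
    ... | inj₁ x∈R∩A | inj₁ y∈R∩A | x⇝y′ = unique (p∩q⊆p R A x∈R∩A) (p∩q⊆p R A y∈R∩A) x⇝y′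
    ... | inj₁ x∈R∩A | inj₂ refl  | x⇝a  =
      contradiction (reach-sym G x⇝a) (unreachable (p∩q⊆p R A x∈R∩A) (p∩q⊆q R A x∈R∩A))
    ... | inj₂ refl  | inj₁ y∈R∩A | a⇝y  =
      contradiction a⇝y (unreachable (p∩q⊆p R A y∈R∩A) (p∩q⊆q R A y∈R∩A))
    ... | inj₂ refl  | inj₂ refl  | _    = refl

  Bound : Subset n → Set
  Bound U = ∀ {R} → Separated U R → ∣ R ∣ ≤ 1 ⊎ ∣ R ∣ ≤ 3 * ∣ S ∩ U ∣

  bound-meeting-S : ∀ {U R} → Bound U → Nonempty (S ∩ U) → Separated U R → ∣ R ∣ ≤ 3 * ∣ S ∩ U ∣
  bound-meeting-S bound (_ , x∈S∩U) sep =
    [ (λ ∣R∣≤1 → ≤-trans ∣R∣≤1 (≤-trans (x∈p⇒1≤∣p∣ x∈S∩U) (m≤n*m _ 3))) , id ] (bound sep)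

  -- The vertex of R in B, if any, is traded for the far end a of an edge
  -- leaving B.
  separated-exit : ∀ {U A B R b a} → Separated U R → Bipartition U A B → B ⊆ U ∩ ∁ S → Linked G B →
                   b ∈ B → a ∈ U ∩ ∁ S → a ∉ B → adj G b a ≡ true →
                   ∃ λ R′ → Separated A R′ × ∣ R ∣ ≤ ∣ R′ ∣
  separated-exit {U} {A} {B} {R} {b} {a} sep bip@(A⊆U , _ , A∩B=∅ , cover) B⊆U∖S B-linked
                 b∈B a∈U∖S a∉B b~a with nonempty? (R ∩ B)
  ... | no R∩B=∅ = R ∩ A , separated-∩ A⊆U sep , ≤-reflexive (begin-equality
    ∣ R ∣                 ≡⟨ ∣p∣≡∣p∩a∣+∣p∩b∣ bip (separated⇒⊆ sep) ⟩
    ∣ R ∩ A ∣ + ∣ R ∩ B ∣ ≡⟨ cong (∣ R ∩ A ∣ +_) (Empty⇒∣p∣≡0 R∩B=∅) ⟩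
    ∣ R ∩ A ∣ + 0         ≡⟨ +-identityʳ _ ⟩
    ∣ R ∩ A ∣             ∎)
    where open ≤-Reasoning
  ... | yes (r , r∈R∩B) = R ∩ A ∪ ⁅ a ⁆ , proj₂ replaced , (begin
    ∣ R ∣                 ≡⟨ ∣p∣≡∣p∩a∣+∣p∩b∣ bip (separated⇒⊆ sep) ⟩
    ∣ R ∩ A ∣ + ∣ R ∩ B ∣ ≤⟨ +-monoʳ-≤ (∣ R ∩ A ∣) (∣R∩B∣≤1 sep B⊆U∖S B-linked) ⟩
    ∣ R ∩ A ∣ + 1         ≡⟨ cong (∣ R ∩ A ∣ +_) (sym (∣⁅x⁆∣≡1 a)) ⟩
    ∣ R ∩ A ∣ + ∣ ⁅ a ⁆ ∣ ≡⟨ sym (∣p∪q∣≡∣p∣+∣q∣ apart) ⟩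
    ∣ R ∩ A ∪ ⁅ a ⁆ ∣     ∎)
    where
    open ≤-Reasoning
    a∈A∖S : a ∈ A ∩ ∁ S
    a∈A∖S with cover (p∩q⊆p U (∁ S) a∈U∖S)
    ... | inj₁ a∈A = x∈p∩q⁺ (a∈A , p∩q⊆q U (∁ S) a∈U∖S)
    ... | inj₂ a∈B = contradiction a∈B a∉B
    r⇝a : Reach G (U ∩ ∁ S) r a
    r⇝a = step (reach-mono G B⊆U∖S (B-linked r b (p∩q⊆q R B r∈R∩B) b∈B)) b~a a∈U∖S
    replaced : a ∉ R × Separated A (R ∩ A ∪ ⁅ a ⁆)
    replaced = separated-replace sep A∩B=∅ A⊆U (p∩q⊆p R B r∈R∩B) (p∩q⊆q R B r∈R∩B) a∈A∖S r⇝a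
    apart : Disjoint (R ∩ A) ⁅ a ⁆
    apart x∈R∩A x∈⁅a⁆ = proj₁ replaced (subst (_∈ R) (x∈⁅y⁆⇒x≡y a x∈⁅a⁆) (p∩q⊆p R A x∈R∩A))

  -- B misses S and is connected, so it lies inside one component of G[U] − S;
  -- unless B is that whole component, an edge leaves B inside U − S.
  free-part : ∀ {U A B R} → Separated U R → Bipartition U A B → Empty (S ∩ B) → Linked G B →
              Bound A → Nonempty (S ∩ A) → ∣ R ∣ ≤ 3 * ∣ S ∩ U ∣ ⊎ Component U B
  free-part {U} {A} {B} {R} sep bip@(_ , B⊆U , _) S∩B=∅ B-linked bound-A S∩A≠∅ = result
    where
    B⊆U∖S : B ⊆ U ∩ ∁ S
    B⊆U∖S x∈B = x∈p∩q⁺ (B⊆U x∈B , x∉p⇒x∈∁p (λ x∈S → S∩B=∅ (_ , x∈p∩q⁺ (x∈S , x∈B))))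
    ∣S∩U∣≡∣S∩A∣ : ∣ S ∩ U ∣ ≡ ∣ S ∩ A ∣
    ∣S∩U∣≡∣S∩A∣ = trans (∣p∩u∣≡∣p∩a∣+∣p∩b∣ bip S)
                        (trans (cong (∣ S ∩ A ∣ +_) (Empty⇒∣p∣≡0 S∩B=∅)) (+-identityʳ _))
    Exit : Set
    Exit = ∃ λ b → ∃ λ a → b ∈ B × a ∈ U ∩ ∁ S × a ∉ B × adj G b a ≡ true
    exit? : Dec Exit
    exit? = any? λ b → any? λ a →
      b ∈? B ×-dec a ∈? U ∩ ∁ S ×-dec ¬? (a ∈? B) ×-dec adj G b a Bool.≟ true
    closed : ¬ Exit → ∀ {x y} → x ∈ B → y ∈ U ∩ ∁ S → adj G x y ≡ true → y ∈ B
    closed no-exit {x} {y} x∈B y∈ x~y with y ∈? B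
    ... | yes y∈B = y∈B
    ... | no  y∉B = contradiction (x , y , x∈B , y∈ , y∉B , x~y) no-exit
    result : ∣ R ∣ ≤ 3 * ∣ S ∩ U ∣ ⊎ Component U B
    result with exit?
    ... | no no-exit = inj₂ (B⊆U∖S , B-linked , closed no-exit)
    ... | yes (b , a , b∈B , a∈U∖S , a∉B , b~a)
      with separated-exit sep bip B⊆U∖S B-linked b∈B a∈U∖S a∉B b~a
    ...   | R′ , sep′ , ∣R∣≤∣R′∣ = inj₁ (≤-trans ∣R∣≤∣R′∣
            (subst (λ s → ∣ R′ ∣ ≤ 3 * s) (sym ∣S∩U∣≡∣S∩A∣) (bound-meeting-S bound-A S∩A≠∅ sep′)))

  two-parts : ∀ {U A B R} → Separated U R → Bipartition U A B → Linked G A → Linked G B →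
              Bound A → Bound B → Nonempty (S ∩ U) →
              ∣ R ∣ ≤ 3 * ∣ S ∩ U ∣ ⊎ Component U A ⊎ Component U B
  two-parts {U} {A} {B} {R} sep bip@(A⊆U , B⊆U , _ , cover) A-linked B-linked bound-A bound-B S∩U≠∅
    with nonempty? (S ∩ A) | nonempty? (S ∩ B)
  ... | yes S∩A≠∅ | yes S∩B≠∅ = inj₁ (begin
    ∣ R ∣                             ≡⟨ ∣p∣≡∣p∩a∣+∣p∩b∣ bip (separated⇒⊆ sep) ⟩
    ∣ R ∩ A ∣ + ∣ R ∩ B ∣             ≤⟨ +-mono-≤ (bound-meeting-S bound-A S∩A≠∅ (separated-∩ A⊆U sep))
                                                  (bound-meeting-S bound-B S∩B≠∅ (separated-∩ B⊆U sep)) ⟩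
    3 * ∣ S ∩ A ∣ + 3 * ∣ S ∩ B ∣     ≡⟨ sym (*-distribˡ-+ 3 (∣ S ∩ A ∣) (∣ S ∩ B ∣)) ⟩
    3 * (∣ S ∩ A ∣ + ∣ S ∩ B ∣)       ≡⟨ cong (3 *_) (sym (∣p∩u∣≡∣p∩a∣+∣p∩b∣ bip S)) ⟩
    3 * ∣ S ∩ U ∣                     ∎)
    where open ≤-Reasoning
  ... | yes S∩A≠∅ | no S∩B=∅ = map₂ inj₂ (free-part sep bip S∩B=∅ B-linked bound-A S∩A≠∅)
  ... | no S∩A=∅ | yes S∩B≠∅ =
    map₂ inj₁ (free-part sep (bipartition-swap bip) S∩A=∅ A-linked bound-B S∩B≠∅)
  ... | no S∩A=∅ | no S∩B=∅ with S∩U≠∅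
  ...   | x , x∈S∩U with cover (p∩q⊆q S U x∈S∩U)
  ...     | inj₁ x∈A = contradiction (x , x∈p∩q⁺ (p∩q⊆p S U x∈S∩U , x∈A)) S∩A=∅
  ...     | inj₂ x∈B = contradiction (x , x∈p∩q⁺ (p∩q⊆p S U x∈S∩U , x∈B)) S∩B=∅

  components-bound : ∀ {U} → RP G U → Bound U
  components-bound (rp-K1 ∣U∣≡1) sep =
    inj₁ (≤-trans (p⊆q⇒∣p∣≤∣q∣ (separated⇒⊆ sep)) (≤-reflexive ∣U∣≡1))
  components-bound {U} (rp (_ , U-linked) parts) {R} sep
    with nonempty? (S ∩ U) | ∣ R ∣ ≤? 3 * ∣ S ∩ U ∣
  ... | no S∩U=∅ | _ =
    inj₁ (subst (_≤ 1) (p⊆q⇒∣p∩q∣≡∣p∣ (separated⇒⊆ sep)) (∣R∩B∣≤1 sep U⊆U∖S U-linked))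
    where
    U⊆U∖S : U ⊆ U ∩ ∁ S
    U⊆U∖S x∈U = x∈p∩q⁺ (x∈U , x∉p⇒x∈∁p (λ x∈S → S∩U=∅ (_ , x∈p∩q⁺ (x∈S , x∈U))))
  ... | yes _ | yes ∣R∣≤3s = inj₂ ∣R∣≤3s
  ... | yes S∩U≠∅ | no ∣R∣≰3s =
    contradiction splits (no-splitting (Component U) component-⊥ component-meet gap)
    where
    open ≤-Reasoning
    5≤s+∣R∣ : 5 ≤ ∣ S ∩ U ∣ + ∣ R ∣
    5≤s+∣R∣ = +-mono-≤ 1≤s (≤-trans (s≤s (*-monoʳ-≤ 3 1≤s)) (≰⇒> ∣R∣≰3s))
      where 1≤s = x∈p⇒1≤∣p∣ (proj₂ S∩U≠∅)
    gap : ∀ {X Z} → Component U X → Component U Z → Disjoint X Z → ∣ X ∣ + ∣ Z ∣ + 3 ≤ ∣ U ∣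
    gap {X} {Z} cX cZ X∩Z=∅ = +-cancelʳ-≤ 2 (∣ X ∣ + ∣ Z ∣ + 3) (∣ U ∣) (begin
      ∣ X ∣ + ∣ Z ∣ + 3 + 2                   ≡⟨ +-assoc (∣ X ∣ + ∣ Z ∣) 3 2 ⟩
      ∣ X ∣ + ∣ Z ∣ + 5                       ≤⟨ +-monoʳ-≤ (∣ X ∣ + ∣ Z ∣) 5≤s+∣R∣ ⟩
      ∣ X ∣ + ∣ Z ∣ + (∣ S ∩ U ∣ + ∣ R ∣)     ≡⟨ sym (+-assoc (∣ X ∣ + ∣ Z ∣) (∣ S ∩ U ∣) (∣ R ∣)) ⟩
      ∣ X ∣ + ∣ Z ∣ + ∣ S ∩ U ∣ + ∣ R ∣       ≤⟨ separated-gap sep cX cZ X∩Z=∅ ⟩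
      ∣ U ∣ + 2                               ∎)
    splits : Splits (Component U) ∣ U ∣
    splits a b 1≤a 1≤b a+b≡∣U∣
      with parts 2 (λ { zero → a ; (suc _) → b })
                 (s≤s (s≤s z≤n) , (λ { zero → 1≤a ; (suc zero) → 1≤b }) ,
                  trans (cong (a +_) (+-identityʳ b)) a+b≡∣U∣)
    ... | A , partition , ∣A∣≡ , A-rp
      with two-parts sep (IsPartition⇒Bipartition G partition)
                     (RP⇒Linked G (A-rp zero)) (RP⇒Linked G (A-rp (suc zero)))
                     (components-bound (A-rp zero)) (components-bound (A-rp (suc zero))) S∩U≠∅
    ...   | inj₁ ∣R∣≤3s        = contradiction ∣R∣≤3s ∣R∣≰3s
    ...   | inj₂ (inj₁ A₀-comp) = A zero , A₀-comp , inj₁ (∣A∣≡ zero)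
    ...   | inj₂ (inj₂ A₁-comp) = A (suc zero) , A₁-comp , inj₂ (∣A∣≡ (suc zero))

  representatives : ∀ {c} → NumComponents G (∁ S) c → ∃ λ R → Separated ⊤ R × ∣ R ∣ ≡ c
  representatives {c} (C , (C⊆ , C-disjoint , C-cover) , C-connected , C-no-edges) =
    image rep , (R⊆ , unique) , ∣image∣≡c rep rep-injective
    where
    rep : Fin c → Fin n
    rep i = proj₁ (proj₁ (C-connected i))
    rep∈C : ∀ i → rep i ∈ C i
    rep∈C i = proj₂ (proj₁ (C-connected i))
    rep-injective : Injective _≡_ _≡_ rep
    rep-injective {i} {j} ri≡rj =
      C-disjoint i j (rep i) (rep∈C i) (subst (_∈ C j) (sym ri≡rj) (rep∈C j))
    component : ∀ i → Component ⊤ (C i)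
    component i = (λ x∈C → x∈p∩q⁺ (∈⊤ , C⊆ i x∈C)) , proj₂ (C-connected i) , closed
      where
      closed : ∀ {x y} → x ∈ C i → y ∈ ⊤ ∩ ∁ S → adj G x y ≡ true → y ∈ C i
      closed x∈C y∈ x~y with C-cover _ (p∩q⊆q ⊤ (∁ S) y∈)
      ... | j , y∈C with C-no-edges i j _ _ x∈C y∈C x~y
      ...   | refl = y∈C
    R⊆ : image rep ⊆ ⊤ ∩ ∁ S
    R⊆ x∈ with ∈-image⁻ rep x∈
    ... | i , refl = proj₁ (component i) (rep∈C i)
    unique : ∀ {x y} → x ∈ image rep → y ∈ image rep → Reach G (⊤ ∩ ∁ S) x y → x ≡ y
    unique x∈ y∈ x⇝y with ∈-image⁻ rep x∈ | ∈-image⁻ rep y∈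
    ... | i , refl | j , refl =
      cong rep (C-disjoint i j (rep j) (component-reach (component i) (rep∈C i) x⇝y) (rep∈C j))

corollary35 : ∀ {n} (G : Graph n) → RP G ⊤ →
  ∀ (S : Subset n) (c : ℕ) → NumComponents G (∁ S) c → 2 ≤ c → c ≤ 3 * ∣ S ∣
corollary35 G rp-G S c components 2≤c with representatives G S components
... | R , sep , ∣R∣≡c with components-bound G S rp-G sep
...   | inj₁ ∣R∣≤1  = contradiction (subst (_≤ 1) ∣R∣≡c ∣R∣≤1) (<⇒≱ 2≤c)
...   | inj₂ ∣R∣≤3s = subst₂ (λ r s → r ≤ 3 * s) ∣R∣≡c (cong ∣_∣ (∩-identityʳ S)) ∣R∣≤3s
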